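{- Let $d$ be a nonnegative integer, and define on $\mathbb{R}_d[X]$ the symmetric bilinear form $$\langle g,f \rangle = \sum_{k=0}^d \frac{f_k\, g_{d-k}}{\binom{d}{k}},$$ where $f=\sum_{k=0}^d f_k x^k$ and $g=\sum_{k=0}^d g_k x^k$. Let $a\in\mathbb{R}$, let $e$ be an integer with $0\le e\le d$, and let $f(x)=(x+a)^{e}$. Then $$\{g\in\mathbb{R}_d[X] ;\ \langle g,f\rangle=0\} = \{g \in \mathbb{R}_d[X];\ g^{(d-e)}(a) =0\}.$$
   Context: $\mathbb{R}_d[X]$ denotes the real vector space of polynomials of degree at most $d$, and $g^{(m)}$ denotes the $m$-th derivative of $g$. -}

module Defs where

open import Level using (Level; _⊔_)
open import Data.Nat as ℕ using (ℕ; zero; suc; _∸_; _<_)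
open import Data.Nat.Combinatorics using (_C_)
open import Relation.Nullary using (¬_)
open import Algebra.Bundles using (CommutativeRing)

module RingNat {c ℓ : Level} (R : CommutativeRing c ℓ) where
  open CommutativeRing R hiding (zero)
  fromℕ : ℕ → Carrier
  fromℕ zero    = 0#
  fromℕ (suc n) = 1# + fromℕ n

record CharZeroField (c ℓ : Level) : Set (Level.suc (c ⊔ ℓ)) where
  field
    commRing : CommutativeRing c ℓ
  open CommutativeRing commRing public
  open RingNat commRing public
  field
    inv     : (x : Carrier) → ¬ (x ≈ 0#) → Carrier
    inv-r   : (x : Carrier) (x≉0 : ¬ (x ≈ 0#)) → x * inv x x≉0 ≈ 1#
    charZero : (n : ℕ) → ¬ (fromℕ (suc n) ≈ 0#)

module Poly {c ℓ : Level} (F : CharZeroField c ℓ) where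
  open CharZeroField F public hiding (zero)

  -- polynomials as coefficient sequences: p k is the coefficient of x^k
  Pol : Set c
  Pol = ℕ → Carrier

  DegLe : ℕ → Pol → Set ℓ
  DegLe d p = ∀ n → d < n → p n ≈ 0#

  pow : Carrier → ℕ → Carrier
  pow x zero    = 1#
  pow x (suc n) = x * pow x n

  sumTo : ℕ → (ℕ → Carrier) → Carrier
  sumTo zero    h = h 0
  sumTo (suc n) h = sumTo n h + h (suc n)

  -- 1/n for n ≥ 1 (dummy value 0 at n = 0, never used below)
  recip : ℕ → Carrier
  recip zero    = 0#
  recip (suc n) = inv (fromℕ (suc n)) (charZero n)

  form : ℕ → Pol → Pol → Carrier
  form d g f = sumTo d (λ k → (f k * g (d ∸ k)) * recip (d C k))

  one : Pol
  one zero    = 1#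
  one (suc k) = 0#

  mulXa : Carrier → Pol → Pol
  mulXa a p zero    = a * p zero
  mulXa a p (suc k) = p k + a * p (suc k)

  linPow : Carrier → ℕ → Pol
  linPow a zero    = one
  linPow a (suc e) = mulXa a (linPow a e)

  deriv : Pol → Pol
  deriv p k = fromℕ (suc k) * p (suc k)

  derivN : ℕ → Pol → Pol
  derivN zero    p = p
  derivN (suc m) p = deriv (derivN m p)

  eval : ℕ → Pol → Carrier → Carrier
  eval d p a = sumTo d (λ k → p k * pow a k)

module Submission where

-- Write m = d - e and k = e - j.  The coefficients of the two
-- polynomials involved are explicit:
--   (x + a)^e has k-th coefficient  C(e,k) a^(e-k),
--   g^(m)     has j-th coefficient  (j+1)(j+2)⋯(j+m) g_(j+m).
-- Both sides therefore reduce to sums over 0 ≤ j ≤ e (terms of ⟨g,f⟩ with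
-- k > e vanish because C(e,k) = 0, terms of g^(m)(a) with j > e vanish
-- because deg g ≤ d), and after reversing the first sum (k = e - j) the
-- factorial identity  d!·C(e,e-j) = C(d,e-j)·e!·(j+1)⋯(j+m)  matches them
-- term by term, giving
--   d! · ⟨g,(x+a)^e⟩ = e! · g^(m)(a).
-- Since d! and e! are invertible in characteristic zero, one side vanishes
-- iff the other does.

open import Defs
open import Level using (Level)
open import Data.Nat using (ℕ; _≤_; _∸_)
open import Data.Product using (_×_)

import Data.Nat as ℕ
open import Data.Product using (_,_)
open import Data.Sum using (inj₁; inj₂)
open import Relation.Nullary using (¬_; yes; no; contradiction)
open import Relation.Binary.PropositionalEquality as ≡ using (_≢_)

module Counting where
  open import Data.Nat
  open import Data.Nat.Properties
  open import Data.Nat.Combinatorics using (_C_; k![n∸k]!∣n!)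
  open import Data.Nat.Combinatorics.Specification using (nCk≡n!/k![n-k]!)
  open import Data.Nat.DivMod using (m/n*n≡m)
  open import Data.Nat.Tactic.RingSolver using (solve-∀)
  open import Relation.Binary.PropositionalEquality
  open ≡-Reasoning

  -- rising j m = (j+1)(j+2)⋯(j+m): the factor produced by differentiating
  -- x^(j+m) exactly m times, leaving x^j.
  rising : ℕ → ℕ → ℕ
  rising j zero    = 1
  rising j (suc m) = suc j * rising (suc j) m

  rising-! : ∀ j m → rising j m * j ! ≡ (j + m) !
  rising-! j zero    = trans (*-identityˡ (j !)) (cong _! (sym (+-identityʳ j)))
  rising-! j (suc m) = begin
    suc j * rising (suc j) m * j !   ≡⟨ cong (_* j !) (*-comm (suc j) (rising (suc j) m)) ⟩
    rising (suc j) m * suc j * j !   ≡⟨ *-assoc (rising (suc j) m) (suc j) (j !) ⟩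
    rising (suc j) m * (suc j) !     ≡⟨ rising-! (suc j) m ⟩
    (suc j + m) !                    ≡⟨ cong _! (sym (+-suc j m)) ⟩
    (j + suc m) !                    ∎

  binomial-! : ∀ {n k} → k ≤ n → (n C k) * (k ! * (n ∸ k) !) ≡ n !
  binomial-! {n} {k} k≤n =
    trans (cong (_* (k ! * (n ∸ k) !)) (nCk≡n!/k![n-k]! k≤n))
          (m/n*n≡m {{k !* (n ∸ k) !≢0}} (k![n∸k]!∣n! k≤n))

  -- binomial coefficients inside the range are nonzero (so 1/C(d,k) is meaningful)
  binomial≢0 : ∀ {n k} → k ≤ n → n C k ≢ 0
  binomial≢0 {n} {k} k≤n C≡0 =
    ≢-nonZero⁻¹ (n !) {{n !≢0}}
      (trans (sym (binomial-! k≤n)) (cong (_* (k ! * (n ∸ k) !)) C≡0))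

  -- the index of g paired with x^(e-j) in the form is d - (e - j) = j + (d - e)
  ∸-∸-split : ∀ {d e j} → j ≤ e → e ≤ d → d ∸ (e ∸ j) ≡ j + (d ∸ e)
  ∸-∸-split {d} {e} {j} j≤e e≤d = begin
    d ∸ (e ∸ j)              ≡⟨ cong (_∸ (e ∸ j)) (sym (m∸n+n≡m e≤d)) ⟩
    (d ∸ e + e) ∸ (e ∸ j)    ≡⟨ +-∸-assoc (d ∸ e) (m∸n≤m e j) ⟩
    d ∸ e + (e ∸ (e ∸ j))    ≡⟨ cong (d ∸ e +_) (m∸[m∸n]≡n j≤e) ⟩
    d ∸ e + j                ≡⟨ +-comm (d ∸ e) j ⟩
    j + (d ∸ e)              ∎

  -- The factorial identity matching the two sums term by term:
  --   d! · C(e,e-j) = C(d,e-j) · e! · (j+1)⋯(j+d-e)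
  -- both sides times (e-j)! j! equal d! e!.
  binomial-ratio : ∀ {d e j} → j ≤ e → e ≤ d →
    d ! * (e C (e ∸ j)) ≡ (d C (e ∸ j)) * (e ! * rising j (d ∸ e))
  binomial-ratio {d} {e} {j} j≤e e≤d =
    *-cancelʳ-≡ _ _ (k ! * j !) {{k !* j !≢0}} (begin
      d ! * (e C k) * (k ! * j !)               ≡⟨ *-assoc (d !) (e C k) _ ⟩
      d ! * ((e C k) * (k ! * j !))             ≡⟨ cong (d ! *_) e-side ⟩
      d ! * e !                               ≡⟨ cong (_* e !) (sym d-side) ⟩
      (d C k) * (k ! * (j + m) !) * e !         ≡⟨ cong (λ x → (d C k) * (k ! * x) * e !) (sym (rising-! j m)) ⟩
      (d C k) * (k ! * (rising j m * j !)) * e ! ≡⟨ regroup (d C k) (k !) (rising j m) (j !) (e !) ⟩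
      (d C k) * (e ! * rising j m) * (k ! * j !) ∎)
    where
    k = e ∸ j
    m = d ∸ e
    e-side : (e C k) * (k ! * j !) ≡ e !
    e-side = subst (λ x → (e C k) * (k ! * x !) ≡ e !) (m∸[m∸n]≡n j≤e) (binomial-! (m∸n≤m e j))
    d-side : (d C k) * (k ! * (j + m) !) ≡ d !
    d-side = subst (λ x → (d C k) * (k ! * x !) ≡ d !) (∸-∸-split j≤e e≤d)
                   (binomial-! (≤-trans (m∸n≤m e j) e≤d))
    regroup : ∀ c x r y f → c * (x * (r * y)) * f ≡ c * (f * r) * (x * y)
    regroup = solve-∀

open Counting using (rising; binomial≢0; ∸-∸-split; binomial-ratio)

module _ {c ℓ : Level} (F : CharZeroField c ℓ) where
  open Poly F
  open import Relation.Binary.Reasoning.Setoid setoid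
  open import Algebra.Properties.CommutativeSemigroup *-commutativeSemigroup
    using (x∙yz≈y∙xz)
  open import Algebra.Solver.CommutativeMonoid *-commutativeMonoid
    using (solve; _⊕_; _⊜_)
  import Data.Nat.Properties as ℕₚ
  open import Data.Nat.Combinatorics using (_C_; nCk+nC[k+1]≡[n+1]C[k+1])
  open import Data.Nat.Combinatorics.Specification using (k>n⇒nCk≡0)

  fromℕ-+ : ∀ m n → fromℕ (m ℕ.+ n) ≈ fromℕ m + fromℕ n
  fromℕ-+ ℕ.zero    n = sym (+-identityˡ _)
  fromℕ-+ (ℕ.suc m) n = trans (+-congˡ (fromℕ-+ m n)) (sym (+-assoc _ _ _))

  fromℕ-* : ∀ m n → fromℕ (m ℕ.* n) ≈ fromℕ m * fromℕ n
  fromℕ-* ℕ.zero    n = sym (zeroˡ _)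
  fromℕ-* (ℕ.suc m) n = begin
    fromℕ (n ℕ.+ m ℕ.* n)             ≈⟨ fromℕ-+ n (m ℕ.* n) ⟩
    fromℕ n + fromℕ (m ℕ.* n)         ≈⟨ +-cong (sym (*-identityˡ _)) (fromℕ-* m n) ⟩
    1# * fromℕ n + fromℕ m * fromℕ n  ≈⟨ sym (distribʳ _ _ _) ⟩
    (1# + fromℕ m) * fromℕ n          ∎

  fromℕ-1 : fromℕ 1 ≈ 1#
  fromℕ-1 = +-identityʳ 1#

  fromℕ≉0 : ∀ n → n ≢ 0 → ¬ (fromℕ n ≈ 0#)
  fromℕ≉0 ℕ.zero    n≢0 = contradiction ≡.refl n≢0
  fromℕ≉0 (ℕ.suc n) _   = charZero n

  fromℕ*recip : ∀ n → n ≢ 0 → fromℕ n * recip n ≈ 1#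
  fromℕ*recip ℕ.zero    n≢0 = contradiction ≡.refl n≢0
  fromℕ*recip (ℕ.suc n) _   = inv-r _ _

  cancel-nonzero : ∀ {x y} → ¬ (x ≈ 0#) → x * y ≈ 0# → y ≈ 0#
  cancel-nonzero {x} {y} x≉0 xy≈0 = begin
    y                       ≈⟨ sym (*-identityˡ y) ⟩
    1# * y                  ≈⟨ *-congʳ (sym (inv-r x x≉0)) ⟩
    (x * inv x x≉0) * y     ≈⟨ *-assoc _ _ _ ⟩
    x * (inv x x≉0 * y)     ≈⟨ x∙yz≈y∙xz _ _ _ ⟩
    inv x x≉0 * (x * y)     ≈⟨ *-congˡ xy≈0 ⟩
    inv x x≉0 * 0#          ≈⟨ zeroʳ _ ⟩
    0#                      ∎

  sumTo-cong : ∀ n {h h′} → (∀ k → k ≤ n → h k ≈ h′ k) → sumTo n h ≈ sumTo n h′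
  sumTo-cong ℕ.zero    h≈h′ = h≈h′ 0 ℕ.z≤n
  sumTo-cong (ℕ.suc n) h≈h′ =
    +-cong (sumTo-cong n (λ k k≤n → h≈h′ k (ℕₚ.m≤n⇒m≤1+n k≤n))) (h≈h′ _ ℕₚ.≤-refl)

  sumTo-*ˡ : ∀ n x h → x * sumTo n h ≈ sumTo n (λ k → x * h k)
  sumTo-*ˡ ℕ.zero    x h = refl
  sumTo-*ˡ (ℕ.suc n) x h = trans (distribˡ _ _ _) (+-congʳ (sumTo-*ˡ n x h))

  sumTo-splitFirst : ∀ n h → sumTo (ℕ.suc n) h ≈ h 0 + sumTo n (λ j → h (ℕ.suc j))
  sumTo-splitFirst ℕ.zero    h = refl
  sumTo-splitFirst (ℕ.suc n) h = trans (+-congʳ (sumTo-splitFirst n h)) (+-assoc _ _ _)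

  sumTo-reverse : ∀ n h → sumTo n h ≈ sumTo n (λ j → h (n ∸ j))
  sumTo-reverse ℕ.zero    h = refl
  sumTo-reverse (ℕ.suc n) h = begin
    sumTo n h + h (ℕ.suc n)                   ≈⟨ +-congʳ (sumTo-reverse n h) ⟩
    sumTo n (λ j → h (n ∸ j)) + h (ℕ.suc n)   ≈⟨ +-comm _ _ ⟩
    h (ℕ.suc n) + sumTo n (λ j → h (n ∸ j))   ≈⟨ sym (sumTo-splitFirst n (λ j → h (ℕ.suc n ∸ j))) ⟩
    sumTo (ℕ.suc n) (λ j → h (ℕ.suc n ∸ j))   ∎

  sumTo-truncate : ∀ {n} N h → n ≤ N → (∀ k → n ℕ.< k → k ≤ N → h k ≈ 0#) →
                   sumTo N h ≈ sumTo n h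
  sumTo-truncate ℕ.zero    h ℕ.z≤n _    = refl
  sumTo-truncate (ℕ.suc N) h n≤N  tail≈0 with ℕₚ.m≤n⇒m<n∨m≡n n≤N
  ... | inj₂ ≡.refl       = refl
  ... | inj₁ (ℕ.s≤s n≤N′) =
    trans (+-cong (sumTo-truncate N h n≤N′ (λ k n<k k≤N → tail≈0 k n<k (ℕₚ.m≤n⇒m≤1+n k≤N)))
                  (tail≈0 (ℕ.suc N) (ℕ.s≤s n≤N′) ℕₚ.≤-refl))
          (+-identityʳ _)

  linPow-coef : ∀ a e k → linPow a e k ≈ fromℕ (e C k) * pow a (e ∸ k)
  linPow-coef a ℕ.zero    ℕ.zero    = sym (trans (*-identityʳ _) fromℕ-1)
  linPow-coef a ℕ.zero    (ℕ.suc k) = sym (zeroˡ _)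
  linPow-coef a (ℕ.suc e) ℕ.zero    =
    trans (*-congˡ (linPow-coef a e 0)) (x∙yz≈y∙xz a (fromℕ 1) (pow a e))
  linPow-coef a (ℕ.suc e) (ℕ.suc k) = begin
    linPow a e k + a * linPow a e (ℕ.suc k)
      ≈⟨ +-cong (linPow-coef a e k) (*-congˡ (linPow-coef a e (ℕ.suc k))) ⟩
    fromℕ (e C k) * pow a (e ∸ k) + a * (fromℕ (e C ℕ.suc k) * pow a (e ∸ ℕ.suc k))
      ≈⟨ +-congˡ absorb-a ⟩
    fromℕ (e C k) * pow a (e ∸ k) + fromℕ (e C ℕ.suc k) * pow a (e ∸ k)
      ≈⟨ sym (distribʳ _ _ _) ⟩
    (fromℕ (e C k) + fromℕ (e C ℕ.suc k)) * pow a (e ∸ k)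
      ≈⟨ *-congʳ (sym (fromℕ-+ (e C k) (e C ℕ.suc k))) ⟩
    fromℕ (e C k ℕ.+ e C ℕ.suc k) * pow a (e ∸ k)
      ≡⟨ ≡.cong (λ n → fromℕ n * pow a (e ∸ k)) (nCk+nC[k+1]≡[n+1]C[k+1] e k) ⟩
    fromℕ (ℕ.suc e C ℕ.suc k) * pow a (e ∸ k) ∎
    where
    -- Pascal's rule needs both terms at the power a^(e-k); when k ≥ e the
    -- second term vanishes because C(e,k+1) = 0.
    absorb-a : a * (fromℕ (e C ℕ.suc k) * pow a (e ∸ ℕ.suc k)) ≈ fromℕ (e C ℕ.suc k) * pow a (e ∸ k)
    absorb-a with k ℕ.<? e
    ... | yes k<e = trans (x∙yz≈y∙xz _ _ _)
                          (reflexive (≡.cong (λ n → fromℕ (e C ℕ.suc k) * pow a n)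
                                             (≡.sym (ℕₚ.+-∸-assoc 1 k<e))))
    ... | no  k≮e rewrite k>n⇒nCk≡0 {e} {ℕ.suc k} (ℕ.s≤s (ℕₚ.≮⇒≥ k≮e)) =
      trans (*-congˡ (zeroˡ _)) (trans (zeroʳ _) (sym (zeroˡ _)))

  derivN-coef : ∀ m g j → derivN m g j ≈ fromℕ (rising j m) * g (j ℕ.+ m)
  derivN-coef ℕ.zero    g j =
    sym (trans (*-congʳ fromℕ-1) (trans (*-identityˡ _) (reflexive (≡.cong g (ℕₚ.+-identityʳ j)))))
  derivN-coef (ℕ.suc m) g j = begin
    fromℕ (ℕ.suc j) * derivN m g (ℕ.suc j)
      ≈⟨ *-congˡ (derivN-coef m g (ℕ.suc j)) ⟩
    fromℕ (ℕ.suc j) * (fromℕ (rising (ℕ.suc j) m) * g (ℕ.suc j ℕ.+ m))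
      ≈⟨ sym (*-assoc _ _ _) ⟩
    (fromℕ (ℕ.suc j) * fromℕ (rising (ℕ.suc j) m)) * g (ℕ.suc j ℕ.+ m)
      ≈⟨ *-cong (sym (fromℕ-* (ℕ.suc j) (rising (ℕ.suc j) m)))
                (reflexive (≡.cong g (≡.sym (ℕₚ.+-suc j m)))) ⟩
    fromℕ (rising j (ℕ.suc m)) * g (j ℕ.+ ℕ.suc m) ∎

  -- binomial-ratio transported into F, solved for the weight 1/C(d,e-j):
  --   d! · C(e,e-j) / C(d,e-j) = e! · (j+1)⋯(j+d-e).
  binomial-weight : ∀ {d e j} → j ≤ e → e ≤ d →
    fromℕ (d ℕ.!) * fromℕ (e C (e ∸ j)) * recip (d C (e ∸ j))
      ≈ fromℕ (e ℕ.!) * fromℕ (rising j (d ∸ e))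
  binomial-weight {d} {e} {j} j≤e e≤d = begin
    fromℕ (d ℕ.!) * fromℕ (e C k) * r      ≈⟨ *-congʳ (sym (fromℕ-* (d ℕ.!) (e C k))) ⟩
    fromℕ (d ℕ.! ℕ.* (e C k)) * r            ≡⟨ ≡.cong (λ n → fromℕ n * r) (binomial-ratio j≤e e≤d) ⟩
    fromℕ ((d C k) ℕ.* E) * r                ≈⟨ *-congʳ (fromℕ-* (d C k) E) ⟩
    fromℕ (d C k) * fromℕ E * r            ≈⟨ xy∙z≈xz∙y _ _ _ ⟩
    fromℕ (d C k) * r * fromℕ E            ≈⟨ *-congʳ (fromℕ*recip _ (binomial≢0 (ℕₚ.≤-trans (ℕₚ.m∸n≤m e j) e≤d))) ⟩
    1# * fromℕ E                           ≈⟨ *-identityˡ _ ⟩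
    fromℕ E                                ≈⟨ fromℕ-* (e ℕ.!) (rising j (d ∸ e)) ⟩
    fromℕ (e ℕ.!) * fromℕ (rising j (d ∸ e)) ∎
    where
    k = e ∸ j
    r = recip (d C k)
    E = e ℕ.! ℕ.* rising j (d ∸ e)
    xy∙z≈xz∙y : ∀ x y z → x * y * z ≈ x * z * y
    xy∙z≈xz∙y = solve 3 (λ x y z → (x ⊕ y) ⊕ z ⊜ (x ⊕ z) ⊕ y) refl

  module ScaledIdentity (d : ℕ) (a : Carrier) (e : ℕ) (e≤d : e ≤ d)
                        (g : Pol) (g∈Rd : DegLe d g) where
    m : ℕ
    m = d ∸ e

    formTerm : ℕ → Carrier
    formTerm k = (linPow a e k * g (d ∸ k)) * recip (d C k)

    evalTerm : ℕ → Carrier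
    evalTerm j = derivN m g j * pow a j

    -- terms k > e of the form vanish since C(e,k) = 0
    form-truncated : form d g (linPow a e) ≈ sumTo e formTerm
    form-truncated = sumTo-truncate d formTerm e≤d vanish
      where
      vanish : ∀ k → e ℕ.< k → k ≤ d → formTerm k ≈ 0#
      vanish k e<k _ = begin
        (linPow a e k * g (d ∸ k)) * recip (d C k)             ≈⟨ *-congʳ (*-congʳ (linPow-coef a e k)) ⟩
        (fromℕ (e C k) * pow a (e ∸ k) * g (d ∸ k)) * recip (d C k)
          ≡⟨ ≡.cong (λ n → (fromℕ n * pow a (e ∸ k) * g (d ∸ k)) * recip (d C k)) (k>n⇒nCk≡0 e<k) ⟩
        (0# * pow a (e ∸ k) * g (d ∸ k)) * recip (d C k)       ≈⟨ *-congʳ (*-congʳ (zeroˡ _)) ⟩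
        (0# * g (d ∸ k)) * recip (d C k)                       ≈⟨ *-congʳ (zeroˡ _) ⟩
        0# * recip (d C k)                                     ≈⟨ zeroˡ _ ⟩
        0#                                                     ∎

    -- terms j > e of g^(m)(a) vanish since they involve g_(j+m) with j + m > d
    eval-truncated : eval d (derivN m g) a ≈ sumTo e evalTerm
    eval-truncated = sumTo-truncate d evalTerm e≤d vanish
      where
      vanish : ∀ j → e ℕ.< j → j ≤ d → evalTerm j ≈ 0#
      vanish j e<j _ = begin
        derivN m g j * pow a j                           ≈⟨ *-congʳ (derivN-coef m g j) ⟩
        fromℕ (rising j m) * g (j ℕ.+ m) * pow a j       ≈⟨ *-congʳ (*-congˡ (g∈Rd _ d<j+m)) ⟩
        fromℕ (rising j m) * 0# * pow a j                ≈⟨ *-congʳ (zeroʳ _) ⟩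
        0# * pow a j                                     ≈⟨ zeroˡ _ ⟩
        0#                                               ∎
        where
        d<j+m : d ℕ.< j ℕ.+ m
        d<j+m = ≡.subst (ℕ._< j ℕ.+ m) (ℕₚ.m+[n∸m]≡n e≤d) (ℕₚ.+-monoˡ-< m e<j)

    terms-match : ∀ j → j ≤ e → fromℕ (d ℕ.!) * formTerm (e ∸ j) ≈ fromℕ (e ℕ.!) * evalTerm j
    terms-match j j≤e = begin
      D * ((linPow a e k * g (d ∸ k)) * r)
        ≈⟨ *-congˡ (*-congʳ (*-cong (linPow-coef a e k) (reflexive (≡.cong g (∸-∸-split j≤e e≤d))))) ⟩
      D * ((fromℕ (e C k) * pow a (e ∸ k) * G) * r)
        ≡⟨ ≡.cong (λ n → D * ((fromℕ (e C k) * pow a n * G) * r)) (ℕₚ.m∸[m∸n]≡n j≤e) ⟩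
      D * ((fromℕ (e C k) * pow a j * G) * r)      ≈⟨ collectWeight _ _ _ _ _ ⟩
      (D * fromℕ (e C k) * r) * (pow a j * G)       ≈⟨ *-congʳ (binomial-weight j≤e e≤d) ⟩
      (fromℕ (e ℕ.!) * R) * (pow a j * G)           ≈⟨ separate _ _ _ _ ⟩
      fromℕ (e ℕ.!) * ((R * G) * pow a j)           ≈⟨ *-congˡ (*-congʳ (sym (derivN-coef m g j))) ⟩
      fromℕ (e ℕ.!) * evalTerm j                    ∎
      where
      k = e ∸ j
      r = recip (d C k)
      D = fromℕ (d ℕ.!)
      R = fromℕ (rising j m)
      G = g (j ℕ.+ m)
      collectWeight : ∀ w c p q s → w * ((c * p * q) * s) ≈ (w * c * s) * (p * q)
      collectWeight = solve 5 (λ w c p q s → w ⊕ (((c ⊕ p) ⊕ q) ⊕ s) ⊜ ((w ⊕ c) ⊕ s) ⊕ (p ⊕ q)) refl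
      separate : ∀ f t p q → (f * t) * (p * q) ≈ f * ((t * q) * p)
      separate = solve 4 (λ f t p q → (f ⊕ t) ⊕ (p ⊕ q) ⊜ f ⊕ ((t ⊕ q) ⊕ p)) refl

    scaled-identity : fromℕ (d ℕ.!) * form d g (linPow a e) ≈ fromℕ (e ℕ.!) * eval d (derivN m g) a
    scaled-identity = begin
      fromℕ (d ℕ.!) * form d g (linPow a e)
        ≈⟨ *-congˡ (trans form-truncated (sumTo-reverse e formTerm)) ⟩
      fromℕ (d ℕ.!) * sumTo e (λ j → formTerm (e ∸ j))       ≈⟨ sumTo-*ˡ e _ _ ⟩
      sumTo e (λ j → fromℕ (d ℕ.!) * formTerm (e ∸ j))       ≈⟨ sumTo-cong e terms-match ⟩
      sumTo e (λ j → fromℕ (e ℕ.!) * evalTerm j)             ≈⟨ sym (sumTo-*ˡ e _ _) ⟩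
      fromℕ (e ℕ.!) * sumTo e evalTerm                       ≈⟨ *-congˡ (sym eval-truncated) ⟩
      fromℕ (e ℕ.!) * eval d (derivN m g) a                  ∎

  fromℕ-!≉0 : ∀ n → ¬ (fromℕ (n ℕ.!) ≈ 0#)
  fromℕ-!≉0 n = fromℕ≉0 (n ℕ.!) (ℕ.≢-nonZero⁻¹ (n ℕ.!) {{n ℕₚ.!≢0}})

  zero-iff-zero : ∀ {x y u v} → ¬ (x ≈ 0#) → ¬ (y ≈ 0#) → x * u ≈ y * v →
                  (u ≈ 0# → v ≈ 0#) × (v ≈ 0# → u ≈ 0#)
  zero-iff-zero x≉0 y≉0 xu≈yv =
      (λ u≈0 → cancel-nonzero y≉0 (trans (sym xu≈yv) (trans (*-congˡ u≈0) (zeroʳ _))))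
    , (λ v≈0 → cancel-nonzero x≉0 (trans xu≈yv (trans (*-congˡ v≈0) (zeroʳ _))))

lemma3 : {c ℓ : Level} (F : CharZeroField c ℓ) → let open Poly F in
    (d : ℕ) (a : Carrier) (e : ℕ) → e ≤ d →
    (g : Pol) → DegLe d g →
    ((form d g (linPow a e) ≈ 0# → eval d (derivN (d ∸ e) g) a ≈ 0#)
    × (eval d (derivN (d ∸ e) g) a ≈ 0# → form d g (linPow a e) ≈ 0#))
lemma3 F d a e e≤d g g∈Rd =
  zero-iff-zero F (fromℕ-!≉0 F d) (fromℕ-!≉0 F e)
    (ScaledIdentity.scaled-identity F d a e e≤d g g∈Rd)
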